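{- Let $G$ and $H$ be simple graphs with $V(G)=V(H)=[n]=\{1,\ldots,n\}$, with adjacency matrices $A(G)$ and $A(H)$, and let $\varphi:[n]\to[n]$ be a bijection. Then $\varphi$ is an isomorphism of $G$ onto $H$ (so in particular $G\simeq H$) if and only if for all $x=(x_1,\ldots,x_n)\in\mathbb{R}^n$ $$\det\bigl(A(G)+\mathrm{diag}(x_1,\ldots,x_n)\bigr)=\det\bigl(A(H)+\mathrm{diag}(y_1,\ldots,y_n)\bigr),$$ where $y\in\mathbb{R}^n$ is defined by $y_{\varphi(i)}=x_i$ for $i=1,\ldots,n$ (i.e. the variable attached to vertex $\varphi(i)$ of $H$ is the variable $x_i$ attached to vertex $i$ of $G$).
   Context: The adjacency matrix $A(G)$ of a simple graph $G$ on $[n]$ is the $n\times n$ $0/1$ matrix with $(A(G))_{ij}=1$ iff $\{i,j\}\in E(G)$ (zero diagonal). An isomorphism of $G$ onto $H$ is a bijection $\varphi:V(G)\to V(H)$ with $\{i,j\}\in E(G)\iff\{\varphi(i),\varphi(j)\}\in E(H)$ for all $i,j$. The paper calls $\eta_G(x_1,\ldots,x_n)=\det(A(G)+\mathrm{diag}(x_1,\ldots,x_n))$ the modified characteristic polynomial of $G$.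
   Formalization: The vector x ranges over ℚ^n instead of ℝ^n, so the matrices and their determinants are taken over the rationals. -}

module Defs where

open import Data.Nat using (ℕ; zero; suc)
open import Data.Bool using (Bool; true; false; if_then_else_)
open import Data.Fin using (Fin; zero; suc; punchIn; _≟_)
open import Relation.Nullary.Decidable using (⌊_⌋)
open import Data.Rational using (ℚ; 0ℚ; 1ℚ; _+_; _*_; -_)
open import Relation.Binary.PropositionalEquality using (_≡_)
open import Function.Bundles using (_↔_; Inverse)

record SimpleGraph (n : ℕ) : Set where
  field
    adj   : Fin n → Fin n → Bool
    sym   : ∀ i j → adj i j ≡ adj j i
    irrefl : ∀ i → adj i i ≡ false

open SimpleGraph public

Matrix : ℕ → Set
Matrix n = Fin n → Fin n → ℚ

adjMatrix : ∀ {n} → SimpleGraph n → Matrix n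
adjMatrix G i j = if adj G i j then 1ℚ else 0ℚ

diag : ∀ {n} → (Fin n → ℚ) → Matrix n
diag x i j = if ⌊ i ≟ j ⌋ then x i else 0ℚ

_⊕_ : ∀ {n} → Matrix n → Matrix n → Matrix n
(M ⊕ N) i j = M i j + N i j

sumFin : ∀ {n} → (Fin n → ℚ) → ℚ
sumFin {zero}  f = 0ℚ
sumFin {suc n} f = f zero + sumFin (λ i → f (suc i))

signFin : ∀ {n} → Fin n → ℚ
signFin zero    = 1ℚ
signFin (suc j) = - signFin j

det : ∀ {n} → Matrix n → ℚ
det {zero}  M = 1ℚ
det {suc n} M =
  sumFin (λ j → signFin j * (M zero j * det (λ i k → M (suc i) (punchIn j k))))

IsIsomorphism : ∀ {n} → SimpleGraph n → SimpleGraph n → (Fin n → Fin n) → Set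
IsIsomorphism G H φ = ∀ i j → adj G i j ≡ adj H (φ i) (φ j)

-- Relabelling the vertices of H along φ permutes the rows and columns of
-- A(H) + diag(y) simultaneously, and a simultaneous permutation does not change
-- the determinant (it is a product of adjacent transpositions, each of which
-- flips the sign twice); this gives the forward direction.
-- Conversely, let A(G) and N := A(H) relabelled along φ have the same modified
-- characteristic polynomial. Its coefficient of x₁ (a difference of two
-- evaluations) is the polynomial of the matrices with vertex 1 deleted, and by
-- relabelling any vertex can be deleted. Deleting all vertices but i and j
-- leaves 2 × 2 matrices with zero diagonal, whose determinants at x = 0 are
-- -A(G)ᵢⱼA(G)ⱼᵢ and -NᵢⱼNⱼᵢ. For 0/1 symmetric matrices these products are the
-- entries themselves, so A(G) = N, i.e. φ is an isomorphism.
module Submission where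

open import Defs hiding (sym)
open import Data.Nat using (ℕ; zero; suc)
open import Data.Fin using (Fin; zero; suc; punchIn; punchOut; lift; _≟_)
open import Data.Fin.Properties using (punchIn-punchOut; punchOut-injective)
open import Data.Fin.Permutation
  using (Permutation′; _⟨$⟩ʳ_; _⟨$⟩ˡ_; inverseˡ; insert; insert-punchIn; remove; punchIn-permute)
import Data.Fin.Permutation as Perm
open import Data.Vec.Functional using (_∷_)
open import Data.Rational using (ℚ; 0ℚ; 1ℚ; _+_; _*_; -_; _-_)
open import Data.Rational.Properties
  using (*-comm; *-zeroʳ; *-distribˡ-+; neg-distrib-+; neg-distribˡ-*; neg-distribʳ-*; neg-injective)
open import Data.Rational.Solver using (module +-*-Solver)
open import Data.Product using (_×_; _,_; ∃)
open import Data.Bool using (true; false; if_then_else_)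
open import Relation.Nullary using (yes; no; contradiction)
open import Relation.Binary.PropositionalEquality
open import Function using (_∘_; Inverse; _↔_)
open +-*-Solver using (solve; _:=_; _:+_; _:*_; :-_; con)

open ≡-Reasoning

sumFin-cong : ∀ {n} {f g : Fin n → ℚ} → f ≗ g → sumFin f ≡ sumFin g
sumFin-cong {zero}  f≗g = refl
sumFin-cong {suc n} f≗g = cong₂ _+_ (f≗g zero) (sumFin-cong (f≗g ∘ suc))

sumFin-neg : ∀ {n} (f : Fin n → ℚ) → sumFin (λ i → - f i) ≡ - sumFin f
sumFin-neg {zero}  f = refl
sumFin-neg {suc n} f = begin
  - f zero + sumFin (λ i → - f (suc i)) ≡⟨ cong (- f zero +_) (sumFin-neg (f ∘ suc)) ⟩
  - f zero + - sumFin (f ∘ suc)          ≡⟨ neg-distrib-+ (f zero) _ ⟨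
  - sumFin f                             ∎

sumFin-+ : ∀ {n} (f g : Fin n → ℚ) → sumFin (λ i → f i + g i) ≡ sumFin f + sumFin g
sumFin-+ {zero}  f g = refl
sumFin-+ {suc n} f g = begin
  (f zero + g zero) + sumFin (λ i → f (suc i) + g (suc i))
    ≡⟨ cong ((f zero + g zero) +_) (sumFin-+ (f ∘ suc) (g ∘ suc)) ⟩
  (f zero + g zero) + (sumFin (f ∘ suc) + sumFin (g ∘ suc))
    ≡⟨ solve 4 (λ a b c d → (a :+ b) :+ (c :+ d) := (a :+ c) :+ (b :+ d)) refl
               (f zero) (g zero) (sumFin (f ∘ suc)) (sumFin (g ∘ suc)) ⟩
  sumFin f + sumFin g
    ∎

*-distribˡ-sumFin : ∀ {n} (a : ℚ) (f : Fin n → ℚ) → a * sumFin f ≡ sumFin (λ i → a * f i)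
*-distribˡ-sumFin {zero}  a f = *-zeroʳ a
*-distribˡ-sumFin {suc n} a f =
  trans (*-distribˡ-+ a (f zero) _) (cong (a * f zero +_) (*-distribˡ-sumFin a (f ∘ suc)))

*-neg-inner : ∀ a b c → a * (b * - c) ≡ - (a * (b * c))
*-neg-inner a b c = trans (cong (a *_) (sym (neg-distribʳ-* b c))) (sym (neg-distribʳ-* a (b * c)))

sumFin² : ∀ {m n} → (Fin m → Fin n → ℚ) → ℚ
sumFin² F = sumFin (λ j → sumFin (F j))

adjSwap : ∀ {m} → Fin m → Fin (suc m) → Fin (suc m)
adjSwap zero    zero          = suc zero
adjSwap zero    (suc zero)    = zero
adjSwap zero    (suc (suc k)) = suc (suc k)
adjSwap (suc p) zero          = zero
adjSwap (suc p) (suc k)       = suc (adjSwap p k)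

adjSwap-involutive : ∀ {m} (p : Fin m) i → adjSwap p (adjSwap p i) ≡ i
adjSwap-involutive zero    zero          = refl
adjSwap-involutive zero    (suc zero)    = refl
adjSwap-involutive zero    (suc (suc i)) = refl
adjSwap-involutive (suc p) zero          = refl
adjSwap-involutive (suc p) (suc i)       = cong suc (adjSwap-involutive p i)

sumFin-adjSwap : ∀ {m} (p : Fin m) (f : Fin (suc m) → ℚ) → sumFin (f ∘ adjSwap p) ≡ sumFin f
sumFin-adjSwap zero    f = solve 3 (λ a b c → b :+ (a :+ c) := a :+ (b :+ c)) refl
                                   (f zero) (f (suc zero)) (sumFin (λ i → f (suc (suc i))))
sumFin-adjSwap (suc p) f = cong (f zero +_) (sumFin-adjSwap p (f ∘ suc))

-- Deleting column j after swapping columns p and p+1: either j is one of the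
-- swapped columns, or the swap survives in the minor as a swap at some q.
data AdjSwapMinor {m} (p : Fin (suc m)) (j : Fin (suc (suc m))) : Set where
  swapped  : (∀ k → adjSwap p (punchIn j k) ≡ punchIn (adjSwap p j) k) →
             signFin j ≡ - signFin (adjSwap p j) → AdjSwapMinor p j
  survives : (q : Fin m) → (∀ k → adjSwap p (punchIn j k) ≡ punchIn (adjSwap p j) (adjSwap q k)) →
             signFin j ≡ signFin (adjSwap p j) → AdjSwapMinor p j

adjSwapMinor : ∀ {m} (p : Fin (suc m)) j → AdjSwapMinor p j
adjSwapMinor zero zero =
  swapped (λ { zero → refl ; (suc k) → refl }) (solve 1 (λ a → a := :- (:- a)) refl 1ℚ)
adjSwapMinor zero (suc zero) = swapped (λ { zero → refl ; (suc k) → refl }) refl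
adjSwapMinor {suc m} zero (suc (suc j)) =
  survives zero (λ { zero → refl ; (suc zero) → refl ; (suc (suc k)) → refl }) refl
adjSwapMinor {suc m} (suc p) zero = survives p (λ k → refl) refl
adjSwapMinor {suc m} (suc p) (suc j) with adjSwapMinor p j
... | swapped e s    = swapped (λ { zero → refl ; (suc k) → cong suc (e k) }) (cong -_ s)
... | survives q e s = survives (suc q) (λ { zero → refl ; (suc k) → cong suc (e k) }) (cong -_ s)

-- The determinant is alternating under adjacent swaps

det-cong : ∀ {n} {M N : Matrix n} → (∀ i j → M i j ≡ N i j) → det M ≡ det N
det-cong {zero}  M≗N = refl
det-cong {suc n} M≗N = sumFin-cong λ j →
  cong₂ (λ a b → signFin j * (a * b)) (M≗N zero j) (det-cong (λ i k → M≗N (suc i) (punchIn j k)))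

minorDet : ∀ {m} → Matrix (suc m) → Fin (suc m) → ℚ
minorDet M j = det (λ i k → M (suc i) (punchIn j k))

det-swapColumns : ∀ {m} (p : Fin m) (M : Matrix (suc m)) →
  det (λ i k → M i (adjSwap p k)) ≡ - det M
det-swapColumns {suc m} p M = begin
  sumFin (λ j → signFin j * (M zero (adjSwap p j) * det (λ i k → M (suc i) (adjSwap p (punchIn j k)))))
    ≡⟨ sumFin-cong term ⟩
  sumFin (λ j → - T (adjSwap p j))  ≡⟨ sumFin-neg (T ∘ adjSwap p) ⟩
  - sumFin (T ∘ adjSwap p)          ≡⟨ cong -_ (sumFin-adjSwap p T) ⟩
  - det M                           ∎
  where
  T : Fin (suc (suc m)) → ℚ
  T j = signFin j * (M zero j * minorDet M j)
  term : ∀ j → signFin j * (M zero (adjSwap p j) * det (λ i k → M (suc i) (adjSwap p (punchIn j k))))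
             ≡ - T (adjSwap p j)
  term j with adjSwapMinor p j
  ... | swapped e s = trans
    (cong₂ (λ a b → a * (M zero (adjSwap p j) * b)) s (det-cong (λ i k → cong (M (suc i)) (e k))))
    (sym (neg-distribˡ-* (signFin (adjSwap p j)) (M zero (adjSwap p j) * minorDet M (adjSwap p j))))
  ... | survives q e s = trans
    (cong₂ (λ a b → a * (M zero (adjSwap p j) * b)) s
      (trans (det-cong (λ i k → cong (M (suc i)) (e k)))
             (det-swapColumns q (λ i k → M (suc i) (punchIn (adjSwap p j) k)))))
    (*-neg-inner (signFin (adjSwap p j)) (M zero (adjSwap p j)) (minorDet M (adjSwap p j)))

-- partner j k is the position of column j once column punchIn j k is deleted,
-- so that deleting j then k equals deleting punchIn j k then partner j k.
partner : ∀ {n} → Fin (suc (suc n)) → Fin (suc n) → Fin (suc n)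
partner zero    k       = zero
partner (suc j) zero    = j
partner {suc n} (suc j) (suc k) = suc (partner j k)

punchIn-partner : ∀ {n} (j : Fin (suc (suc n))) k → punchIn (punchIn j k) (partner j k) ≡ j
punchIn-partner zero    k       = refl
punchIn-partner (suc j) zero    = refl
punchIn-partner {suc n} (suc j) (suc k) = cong suc (punchIn-partner j k)

punchIn-punchIn-partner : ∀ {n} (j : Fin (suc (suc n))) k l →
  punchIn j (punchIn k l) ≡ punchIn (punchIn j k) (punchIn (partner j k) l)
punchIn-punchIn-partner zero    k       l       = refl
punchIn-punchIn-partner (suc j) zero    l       = refl
punchIn-punchIn-partner {suc n} (suc j) (suc k) zero    = refl
punchIn-punchIn-partner {suc n} (suc j) (suc k) (suc l) = cong suc (punchIn-punchIn-partner j k l)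

signFin-partner : ∀ {n} (j : Fin (suc (suc n))) k →
  signFin (punchIn j k) * signFin (partner j k) ≡ - (signFin j * signFin k)
signFin-partner zero    k    = solve 1 (λ a → (:- a) :* con 1ℚ := :- (con 1ℚ :* a)) refl (signFin k)
signFin-partner (suc j) zero = solve 1 (λ a → con 1ℚ :* a := :- ((:- a) :* con 1ℚ)) refl (signFin j)
signFin-partner {suc n} (suc j) (suc k) = begin
  (- signFin (punchIn j k)) * (- signFin (partner j k))
    ≡⟨ solve 2 (λ a b → (:- a) :* (:- b) := a :* b) refl (signFin (punchIn j k)) (signFin (partner j k)) ⟩
  signFin (punchIn j k) * signFin (partner j k)
    ≡⟨ signFin-partner j k ⟩
  - (signFin j * signFin k)
    ≡⟨ solve 2 (λ a b → :- (a :* b) := :- ((:- a) :* (:- b))) refl (signFin j) (signFin k) ⟩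
  - ((- signFin j) * (- signFin k))
    ∎

sumFin²-partner : ∀ {n} (F : Fin (suc (suc n)) → Fin (suc n) → ℚ) →
  sumFin² F ≡ sumFin² (λ j k → F (punchIn j k) (partner j k))
sumFin²-partner {zero} F =
  solve 2 (λ a b → (a :+ con 0ℚ) :+ ((b :+ con 0ℚ) :+ con 0ℚ)
                := (b :+ con 0ℚ) :+ ((a :+ con 0ℚ) :+ con 0ℚ)) refl (F zero zero) (F (suc zero) zero)
sumFin²-partner {suc n} F = begin
  A + sumFin (λ j → F (suc j) zero + sumFin (F′ j))
    ≡⟨ cong (A +_) (sumFin-+ (λ j → F (suc j) zero) (sumFin ∘ F′)) ⟩
  A + (B + sumFin² F′)
    ≡⟨ cong (λ z → A + (B + z)) (sumFin²-partner F′) ⟩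
  A + (B + sumFin² F″)
    ≡⟨ solve 3 (λ a b c → a :+ (b :+ c) := b :+ (a :+ c)) refl A B (sumFin² F″) ⟩
  B + (A + sumFin² F″)
    ≡⟨ cong (B +_) (sumFin-+ (F zero) (sumFin ∘ F″)) ⟨
  B + sumFin (λ j → F zero j + sumFin (F″ j))
    ∎
  where
  F′ : Fin (suc (suc n)) → Fin (suc n) → ℚ
  F′ j k = F (suc j) (suc k)
  F″ : Fin (suc (suc n)) → Fin (suc n) → ℚ
  F″ j k = F′ (punchIn j k) (partner j k)
  A B : ℚ
  A = sumFin (F zero)
  B = sumFin (λ j → F (suc j) zero)

laplaceTwoRowTerm : ∀ {m} → Matrix (suc (suc m)) → Fin (suc (suc m)) → Fin (suc m) → ℚ
laplaceTwoRowTerm N j k = signFin j * (N zero j * (signFin k * (N (suc zero) (punchIn j k) *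
  det (λ i l → N (suc (suc i)) (punchIn j (punchIn k l))))))

det-expandTwoRows : ∀ {m} (N : Matrix (suc (suc m))) → det N ≡ sumFin² (laplaceTwoRowTerm N)
det-expandTwoRows N = sumFin-cong λ j → trans
  (cong (signFin j *_) (*-distribˡ-sumFin (N zero j) (λ k → signFin k * (N (suc zero) (punchIn j k) * D j k))))
  (*-distribˡ-sumFin (signFin j) (λ k → N zero j * (signFin k * (N (suc zero) (punchIn j k) * D j k))))
  where
  D : ∀ j k → ℚ
  D j k = det (λ i l → N (suc (suc i)) (punchIn j (punchIn k l)))

laplaceTwoRowTerm-swapRows : ∀ {m} (M : Matrix (suc (suc m))) j k →
  laplaceTwoRowTerm (λ i → M (adjSwap zero i)) (punchIn j k) (partner j k) ≡ - laplaceTwoRowTerm M j k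
laplaceTwoRowTerm-swapRows M j k = begin
  σ * (b * (τ * (M zero (punchIn (punchIn j k) (partner j k)) *
    det (λ i l → M (suc (suc i)) (punchIn (punchIn j k) (punchIn (partner j k) l))))))
    ≡⟨ cong₂ (λ c d → σ * (b * (τ * (M zero c * d))))
             (punchIn-partner j k)
             (det-cong (λ i l → cong (M (suc (suc i))) (sym (punchIn-punchIn-partner j k l)))) ⟩
  σ * (b * (τ * (a * D)))
    ≡⟨ solve 5 (λ σ τ a b D → σ :* (b :* (τ :* (a :* D))) := (σ :* τ) :* (a :* b :* D)) refl σ τ a b D ⟩
  (σ * τ) * (a * b * D)
    ≡⟨ cong (_* (a * b * D)) (signFin-partner j k) ⟩
  - (signFin j * signFin k) * (a * b * D)
    ≡⟨ solve 5 (λ s t a b D → (:- (s :* t)) :* (a :* b :* D) := :- (s :* (a :* (t :* (b :* D))))) refl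
               (signFin j) (signFin k) a b D ⟩
  - laplaceTwoRowTerm M j k
    ∎
  where
  σ τ a b D : ℚ
  σ = signFin (punchIn j k)
  τ = signFin (partner j k)
  a = M zero j
  b = M (suc zero) (punchIn j k)
  D = det (λ i l → M (suc (suc i)) (punchIn j (punchIn k l)))

det-swapRows : ∀ {m} (p : Fin m) (M : Matrix (suc m)) → det (λ i → M (adjSwap p i)) ≡ - det M
det-swapRows {suc m} zero M = begin
  det (λ i → M (adjSwap zero i))
    ≡⟨ det-expandTwoRows (λ i → M (adjSwap zero i)) ⟩
  sumFin² (laplaceTwoRowTerm (λ i → M (adjSwap zero i)))
    ≡⟨ sumFin²-partner (laplaceTwoRowTerm (λ i → M (adjSwap zero i))) ⟩
  sumFin² (λ j k → laplaceTwoRowTerm (λ i → M (adjSwap zero i)) (punchIn j k) (partner j k))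
    ≡⟨ sumFin-cong (λ j → sumFin-cong (laplaceTwoRowTerm-swapRows M j)) ⟩
  sumFin (λ j → sumFin (λ k → - laplaceTwoRowTerm M j k))
    ≡⟨ sumFin-cong (λ j → sumFin-neg (laplaceTwoRowTerm M j)) ⟩
  sumFin (λ j → - sumFin (laplaceTwoRowTerm M j))
    ≡⟨ sumFin-neg (sumFin ∘ laplaceTwoRowTerm M) ⟩
  - sumFin² (laplaceTwoRowTerm M)
    ≡⟨ cong -_ (det-expandTwoRows M) ⟨
  - det M
    ∎
det-swapRows {suc m} (suc p) M = trans
  (sumFin-cong λ j → trans
    (cong (λ z → signFin j * (M zero j * z)) (det-swapRows p (λ i k → M (suc i) (punchIn j k))))
    (*-neg-inner (signFin j) (M zero j) (minorDet M j)))
  (sumFin-neg (λ j → signFin j * (M zero j * minorDet M j)))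

-- Simultaneous permutations of rows and columns

relabel : ∀ {m n} → (Fin m → Fin n) → Matrix n → Matrix m
relabel f M i j = M (f i) (f j)

det-relabel-adjSwap : ∀ {m} (p : Fin m) (M : Matrix (suc m)) → det (relabel (adjSwap p) M) ≡ det M
det-relabel-adjSwap p M = begin
  det (relabel (adjSwap p) M)          ≡⟨ det-swapRows p (λ i k → M i (adjSwap p k)) ⟩
  - det (λ i k → M i (adjSwap p k))    ≡⟨ cong -_ (det-swapColumns p M) ⟩
  - (- det M)                          ≡⟨ solve 1 (λ a → :- (:- a) := a) refl (det M) ⟩
  det M                                ∎

data IsAdjSwapProduct : ∀ {n} → (Fin n → Fin n) → Set where
  identity    : ∀ {n} → IsAdjSwapProduct {n} (λ i → i)
  swap        : ∀ {m} (p : Fin m) → IsAdjSwapProduct (adjSwap p)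
  compose     : ∀ {n} {f g : Fin n → Fin n} →
                IsAdjSwapProduct f → IsAdjSwapProduct g → IsAdjSwapProduct (f ∘ g)
  extensional : ∀ {n} {f g : Fin n → Fin n} → IsAdjSwapProduct f → f ≗ g → IsAdjSwapProduct g

det-relabel-adjSwapProduct : ∀ {n} {f : Fin n → Fin n} → IsAdjSwapProduct f →
  ∀ (M : Matrix n) → det (relabel f M) ≡ det M
det-relabel-adjSwapProduct identity       M = refl
det-relabel-adjSwapProduct (swap p)       M = det-relabel-adjSwap p M
det-relabel-adjSwapProduct (compose {f = f} F G) M =
  trans (det-relabel-adjSwapProduct G (relabel f M)) (det-relabel-adjSwapProduct F M)
det-relabel-adjSwapProduct (extensional F f≗g) M =
  trans (det-cong (λ i j → sym (cong₂ M (f≗g i) (f≗g j)))) (det-relabel-adjSwapProduct F M)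

lift-adjSwapProduct : ∀ {n} {f : Fin n → Fin n} → IsAdjSwapProduct f → IsAdjSwapProduct (lift 1 f)
lift-adjSwapProduct identity = extensional identity λ { zero → refl ; (suc i) → refl }
lift-adjSwapProduct (swap p) = extensional (swap (suc p)) λ { zero → refl ; (suc i) → refl }
lift-adjSwapProduct (compose F G) =
  extensional (compose (lift-adjSwapProduct F) (lift-adjSwapProduct G)) λ { zero → refl ; (suc i) → refl }
lift-adjSwapProduct (extensional F f≗g) =
  extensional (lift-adjSwapProduct F) λ { zero → refl ; (suc i) → cong suc (f≗g i) }

cycleTo : ∀ {n} → Fin (suc n) → Fin (suc n) → Fin (suc n)
cycleTo p zero    = p
cycleTo p (suc j) = punchIn p j

cycleTo-adjSwapProduct : ∀ {n} (p : Fin (suc n)) → IsAdjSwapProduct (cycleTo p)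
cycleTo-adjSwapProduct zero = extensional identity λ { zero → refl ; (suc i) → refl }
cycleTo-adjSwapProduct {suc n} (suc p) =
  extensional (compose (lift-adjSwapProduct (cycleTo-adjSwapProduct p)) (swap zero))
    λ { zero → refl ; (suc zero) → refl ; (suc (suc j)) → refl }

permutation-adjSwapProduct : ∀ {n} (π : Permutation′ n) → IsAdjSwapProduct (π ⟨$⟩ʳ_)
permutation-adjSwapProduct {zero}  π = extensional identity λ ()
permutation-adjSwapProduct {suc n} π =
  extensional (compose (cycleTo-adjSwapProduct (π ⟨$⟩ʳ zero))
                       (lift-adjSwapProduct (permutation-adjSwapProduct (remove zero π))))
    λ { zero → refl ; (suc j) → sym (punchIn-permute π zero j) }

det-relabel : ∀ {n} (π : Permutation′ n) (M : Matrix n) → det (relabel (π ⟨$⟩ʳ_) M) ≡ det M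
det-relabel π = det-relabel-adjSwapProduct (permutation-adjSwapProduct π)

diag-relabel : ∀ {n} (π : Permutation′ n) (x : Fin n → ℚ) i j →
  diag x i j ≡ relabel (π ⟨$⟩ʳ_) (diag (λ k → x (π ⟨$⟩ˡ k))) i j
diag-relabel π x i j with i ≟ j | π ⟨$⟩ʳ i ≟ π ⟨$⟩ʳ j
... | yes refl | yes _   = sym (cong x (inverseˡ π))
... | yes refl | no πi≢πi = contradiction refl πi≢πi
... | no i≢j  | yes πi≡πj =
  contradiction (trans (sym (inverseˡ π)) (trans (cong (π ⟨$⟩ˡ_) πi≡πj) (inverseˡ π))) i≢j
... | no _    | no _     = refl

-- The modified characteristic polynomial

η : ∀ {n} → Matrix n → (Fin n → ℚ) → ℚ
η M x = det (M ⊕ diag x)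

η-cong : ∀ {n} {M N : Matrix n} → (∀ i j → M i j ≡ N i j) → ∀ x → η M x ≡ η N x
η-cong M≗N x = det-cong (λ i j → cong (_+ diag x i j) (M≗N i j))

η-relabel : ∀ {n} (π : Permutation′ n) (M : Matrix n) x →
  η (relabel (π ⟨$⟩ʳ_) M) x ≡ η M (λ k → x (π ⟨$⟩ˡ k))
η-relabel π M x = trans
  (det-cong (λ i j → cong (relabel (π ⟨$⟩ʳ_) M i j +_) (diag-relabel π x i j)))
  (det-relabel π (M ⊕ diag (λ k → x (π ⟨$⟩ˡ k))))

-- The coefficient of x₁, extracted as a difference of two evaluations.
η-minor : ∀ {n} (M : Matrix (suc n)) y → η (relabel suc M) y ≡ η M (1ℚ ∷ y) - η M (0ℚ ∷ y)
η-minor {n} M y = begin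
  η (relabel suc M) y
    ≡⟨ det-cong (λ i k → cong (M (suc i) (suc k) +_) (diag-tail i k)) ⟨
  D
    ≡⟨ solve 3 (λ m d r → d := (con 1ℚ :* ((m :+ con 1ℚ) :* d) :+ r) :+ :- (con 1ℚ :* ((m :+ con 0ℚ) :* d) :+ r))
               refl (M zero zero) D R ⟩
  η M (1ℚ ∷ y) - η M (0ℚ ∷ y)
    ∎
  where
  diag-tail : ∀ i k → diag (0ℚ ∷ y) (suc i) (suc k) ≡ diag y i k
  diag-tail i k with i ≟ k
  ... | yes _ = refl
  ... | no _  = refl
  D R : ℚ
  D = det (λ i k → M (suc i) (suc k) + diag (0ℚ ∷ y) (suc i) (suc k))
  R = sumFin (λ j → signFin (suc j) * ((M zero (suc j) + diag (0ℚ ∷ y) zero (suc j)) *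
        det (λ i k → M (suc i) (punchIn (suc j) k) + diag (0ℚ ∷ y) (suc i) (punchIn (suc j) k))))

_≈η_ : ∀ {n} → Matrix n → Matrix n → Set
M ≈η N = ∀ x → η M x ≡ η N x

≈η-relabel : ∀ {n} (π : Permutation′ n) {M N : Matrix n} → M ≈η N →
  relabel (π ⟨$⟩ʳ_) M ≈η relabel (π ⟨$⟩ʳ_) N
≈η-relabel π {M} {N} M≈N x =
  trans (η-relabel π M x) (trans (M≈N (λ k → x (π ⟨$⟩ˡ k))) (sym (η-relabel π N x)))

≈η-minor : ∀ {n} {M N : Matrix (suc n)} → M ≈η N → relabel suc M ≈η relabel suc N
≈η-minor {M = M} {N} M≈N y = begin
  η (relabel suc M) y               ≡⟨ η-minor M y ⟩
  η M (1ℚ ∷ y) - η M (0ℚ ∷ y)       ≡⟨ cong₂ _-_ (M≈N (1ℚ ∷ y)) (M≈N (0ℚ ∷ y)) ⟩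
  η N (1ℚ ∷ y) - η N (0ℚ ∷ y)       ≡⟨ η-minor N y ⟨
  η (relabel suc N) y               ∎

-- Deleting vertex k is deleting vertex 1 after moving k to the front.
≈η-punchIn : ∀ {n} (k : Fin (suc n)) {M N : Matrix (suc n)} → M ≈η N →
  relabel (punchIn k) M ≈η relabel (punchIn k) N
≈η-punchIn k {M} {N} M≈N y = begin
  η (relabel (punchIn k) M) y   ≡⟨ η-cong (front M) y ⟩
  η (relabel suc (relabel (ρ ⟨$⟩ʳ_) M)) y
    ≡⟨ ≈η-minor {M = relabel (ρ ⟨$⟩ʳ_) M} {relabel (ρ ⟨$⟩ʳ_) N} (≈η-relabel ρ {M} {N} M≈N) y ⟩
  η (relabel suc (relabel (ρ ⟨$⟩ʳ_) N)) y ≡⟨ η-cong (front N) y ⟨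
  η (relabel (punchIn k) N) y   ∎
  where
  ρ : Permutation′ (suc _)
  ρ = insert zero k Perm.id
  front : ∀ K i j → relabel (punchIn k) K i j ≡ relabel suc (relabel (ρ ⟨$⟩ʳ_) K) i j
  front K i j = sym (cong₂ K (insert-punchIn zero k Perm.id i) (insert-punchIn zero k Perm.id j))

-- Recovering the products of symmetric entries

ZeroDiagonal : ∀ {n} → Matrix n → Set
ZeroDiagonal M = ∀ i → M i i ≡ 0ℚ

entryProduct : ∀ {n} → Matrix n → Fin n → Fin n → ℚ
entryProduct M i j = M i j * M j i

η-zeroDiagonal₂ : (M : Matrix 2) → ZeroDiagonal M → η M (λ _ → 0ℚ) ≡ - entryProduct M zero (suc zero)
η-zeroDiagonal₂ M zM rewrite zM zero | zM (suc zero) =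
  solve 2 (λ b c → con 1ℚ :* ((con 0ℚ :+ con 0ℚ) :* (con 1ℚ :* ((con 0ℚ :+ con 0ℚ) :* con 1ℚ) :+ con 0ℚ))
                :+ ((:- con 1ℚ) :* ((b :+ con 0ℚ) :* (con 1ℚ :* ((c :+ con 0ℚ) :* con 1ℚ) :+ con 0ℚ)) :+ con 0ℚ)
                := :- (b :* c))
          refl (M zero (suc zero)) (M (suc zero) zero)

≈η⇒entryProduct₂ : ∀ {M N : Matrix 2} → ZeroDiagonal M → ZeroDiagonal N → M ≈η N →
  entryProduct M zero (suc zero) ≡ entryProduct N zero (suc zero)
≈η⇒entryProduct₂ {M} {N} zM zN M≈N = neg-injective (begin
  - entryProduct M zero (suc zero)   ≡⟨ η-zeroDiagonal₂ M zM ⟨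
  η M (λ _ → 0ℚ)                     ≡⟨ M≈N (λ _ → 0ℚ) ⟩
  η N (λ _ → 0ℚ)                     ≡⟨ η-zeroDiagonal₂ N zN ⟩
  - entryProduct N zero (suc zero)   ∎)

avoidBoth : ∀ {n} (i j : Fin (suc (suc (suc n)))) → ∃ λ k → k ≢ i × k ≢ j
avoidBoth zero          zero          = suc zero , (λ ()) , (λ ())
avoidBoth zero          (suc zero)    = suc (suc zero) , (λ ()) , (λ ())
avoidBoth zero          (suc (suc j)) = suc zero , (λ ()) , (λ ())
avoidBoth (suc zero)    zero          = suc (suc zero) , (λ ()) , (λ ())
avoidBoth (suc (suc i)) zero          = suc zero , (λ ()) , (λ ())
avoidBoth (suc i)       (suc j)       = zero , (λ ()) , (λ ())

-- Delete a vertex other than i and j until two vertices are left.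
≈η⇒entryProduct : ∀ {n} {M N : Matrix n} → ZeroDiagonal M → ZeroDiagonal N → M ≈η N →
  ∀ {i j} → i ≢ j → entryProduct M i j ≡ entryProduct N i j
≈η⇒entryProduct {1} _ _ _ {zero} {zero} i≢j = contradiction refl i≢j
≈η⇒entryProduct {2} _ _ _ {zero}     {zero}     i≢j = contradiction refl i≢j
≈η⇒entryProduct {2} _ _ _ {suc zero} {suc zero} i≢j = contradiction refl i≢j
≈η⇒entryProduct {2} {M} {N} zM zN M≈N {zero} {suc zero} _ = ≈η⇒entryProduct₂ {M} {N} zM zN M≈N
≈η⇒entryProduct {2} {M} {N} zM zN M≈N {suc zero} {zero} _ = begin
  entryProduct M (suc zero) zero   ≡⟨ *-comm (M (suc zero) zero) (M zero (suc zero)) ⟩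
  entryProduct M zero (suc zero)   ≡⟨ ≈η⇒entryProduct₂ {M} {N} zM zN M≈N ⟩
  entryProduct N zero (suc zero)   ≡⟨ *-comm (N zero (suc zero)) (N (suc zero) zero) ⟩
  entryProduct N (suc zero) zero   ∎
≈η⇒entryProduct {suc (suc (suc n))} {M} {N} zM zN M≈N {i} {j} i≢j =
  let k , k≢i , k≢j = avoidBoth i j in begin
  entryProduct M i j
    ≡⟨ cong₂ (entryProduct M) (punchIn-punchOut k≢i) (punchIn-punchOut k≢j) ⟨
  entryProduct (relabel (punchIn k) M) (punchOut k≢i) (punchOut k≢j)
    ≡⟨ ≈η⇒entryProduct {M = relabel (punchIn k) M} {relabel (punchIn k) N} (zM ∘ punchIn k) (zN ∘ punchIn k) (≈η-punchIn k {M} {N} M≈N)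
                       (i≢j ∘ punchOut-injective k≢i k≢j) ⟩
  entryProduct (relabel (punchIn k) N) (punchOut k≢i) (punchOut k≢j)
    ≡⟨ cong₂ (entryProduct N) (punchIn-punchOut k≢i) (punchIn-punchOut k≢j) ⟩
  entryProduct N i j
    ∎

adjMatrix-zeroDiagonal : ∀ {n} (G : SimpleGraph n) → ZeroDiagonal (adjMatrix G)
adjMatrix-zeroDiagonal G i = cong (λ b → if b then 1ℚ else 0ℚ) (irrefl G i)

-- A(G)ᵢⱼ A(G)ⱼᵢ = A(G)ᵢⱼ² = A(G)ᵢⱼ since A(G) is symmetric with 0/1 entries.
adj-≡-from-entryProduct : ∀ {n} (G H : SimpleGraph n) i j k l →
  entryProduct (adjMatrix G) i j ≡ entryProduct (adjMatrix H) k l → adj G i j ≡ adj H k l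
adj-≡-from-entryProduct G H i j k l e
  rewrite SimpleGraph.sym G j i | SimpleGraph.sym H l k with adj G i j | adj H k l
... | true  | true  = refl
... | false | false = refl
... | true  | false = contradiction e λ ()
... | false | true  = contradiction e λ ()

theorem1 : (n : ℕ) (G H : SimpleGraph n) (φ : Fin n ↔ Fin n) →
    (IsIsomorphism G H (Inverse.to φ) →
      ∀ (x : Fin n → ℚ) →
        det (adjMatrix G ⊕ diag x) ≡ det (adjMatrix H ⊕ diag (λ k → x (Inverse.from φ k))))
    ×
    ((∀ (x : Fin n → ℚ) →
        det (adjMatrix G ⊕ diag x) ≡ det (adjMatrix H ⊕ diag (λ k → x (Inverse.from φ k)))) →
      IsIsomorphism G H (Inverse.to φ))
theorem1 n G H φ = forward , backward
  where
  N : Matrix n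
  N = relabel (φ ⟨$⟩ʳ_) (adjMatrix H)

  forward : IsIsomorphism G H (φ ⟨$⟩ʳ_) → ∀ x → η (adjMatrix G) x ≡ η (adjMatrix H) (λ k → x (φ ⟨$⟩ˡ k))
  forward iso x = trans (η-cong (λ i j → cong (λ b → if b then 1ℚ else 0ℚ) (iso i j)) x)
                        (η-relabel φ (adjMatrix H) x)

  backward : (∀ x → η (adjMatrix G) x ≡ η (adjMatrix H) (λ k → x (φ ⟨$⟩ˡ k))) →
    IsIsomorphism G H (φ ⟨$⟩ʳ_)
  backward same i j with i ≟ j
  ... | yes refl = trans (irrefl G i) (sym (irrefl H (φ ⟨$⟩ʳ i)))
  ... | no i≢j   = adj-≡-from-entryProduct G H i j (φ ⟨$⟩ʳ i) (φ ⟨$⟩ʳ j)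
    (≈η⇒entryProduct {M = adjMatrix G} {N} (adjMatrix-zeroDiagonal G)
      (adjMatrix-zeroDiagonal H ∘ (φ ⟨$⟩ʳ_)) A≈N i≢j)
    where
    A≈N : adjMatrix G ≈η N
    A≈N x = trans (same x) (sym (η-relabel φ (adjMatrix H) x))
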